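{- Let $P$, $Q$, $R$ be MIAs with common input alphabet $I$ and common output alphabet $O$, where $P$ and $Q$ have disjoint state sets, and let $p\in P$, $q\in Q$, $r\in R$. Then $p\vee q\sqsubseteq_{\mathrm{MIA}} r$ if and only if $p\sqsubseteq_{\mathrm{MIA}} r$ and $q\sqsubseteq_{\mathrm{MIA}} r$.
   Context: A dMTS is $(P,A,\longrightarrow_P,\dashrightarrow_P)$ with states $P$, alphabet $A$ not containing $\tau$, must-relation $\longrightarrow_P\subseteq P\times A\times(2^P\setminus\{\emptyset\})$, may-relation $\dashrightarrow_P\subseteq P\times(A\cup\{\tau\})\times P$, and syntactic consistency ($p\xrightarrow{a}P'$ implies $p\stackrel{a}{\dashrightarrow}p'$ for all $p'\in P'$). A Modal Interface Automaton (MIA) is $(P,I,O,\longrightarrow_P,\dashrightarrow_P)$ with $I,O$ disjoint such that $(P,I\cup O,\longrightarrow_P,\dashrightarrow_P)$ is a dMTS and for all $i\in I$: (a) $p\xrightarrow{i}P'$ and $p\xrightarrow{i}P''$ imply $P'=P''$; (b) $p\stackrel{i}{\dashrightarrow}p'$ implies $p\xrightarrow{i}P'$ for some $P'\ni p'$. Write $p\stackrel{a}{\dashrightarrow}$ if some may-$a$-transition leaves $p$. Weak may: $p\stackrel{\epsilon}{\Longrightarrow}p'$ iff $p(\stackrel{\tau}{\dashrightarrow})^*p'$; $p\stackrel{\alpha}{\Longrightarrow}p'$ iff $\exists p''.\,p\stackrel{\epsilon}{\Longrightarrow}p''\stackrel{\alpha}{\dashrightarrow}p'$; $\hat\tau=\epsilon$,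 $\hat a=a$. For MIAs $P,Q$ with the same $I,O$, $\mathcal R\subseteq P\times Q$ is a MIA-refinement relation if for all $(p,q)\in\mathcal R$: (i) $q\xrightarrow{a}Q'$ ($a\in I\cup O$) implies some $P'$ with $p\xrightarrow{a}P'$ and $\forall p'\in P'\,\exists q'\in Q'.\,(p',q')\in\mathcal R$; (ii) $p\stackrel{\alpha}{\dashrightarrow}p'$ with $\alpha\in O\cup\{\tau\}$ implies some $q'$ with $q\stackrel{\hat\alpha}{\Longrightarrow}q'$ and $(p',q')\in\mathcal R$. $p\sqsubseteq_{\mathrm{MIA}}q$ iff some such relation contains $(p,q)$. MIA-disjunction: for MIAs $P,Q$ with common $I,O$ and disjoint state sets, $P\vee Q$ has state set $\{p\vee q:p\in P,q\in Q\}\cup P\cup Q$, alphabets $I,O$, and the least must- and may-transition relations containing those of $P$ and $Q$ and satisfying: (Must) $p\vee q\xrightarrow{a}P'\cup Q'$ if $p\xrightarrow{a}_PP'$ and $q\xrightarrow{a}_QQ'$; (May1) $p\vee q\stackrel{\alpha}{\dashrightarrow}p'$ if $p\stackrel{\alpha}{\dashrightarrow}_Pp'$ and, in case $\alpha\in I$, also $q\stackrel{\alpha}{\dashrightarrow}_Q$; (May2) $p\vee q\stackrel{\alpha}{\dashrightarrow}q'$ if $q\stackrel{\alpha}{\dashrightarrow}_Qq'$ and, in case $\alpha\in I$, also $p\stackrel{\alpha}{\dashrightarrow}_P$. -}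

module Defs where

open import Data.Sum using (_⊎_; inj₁; inj₂)
open import Data.Product using (Σ; ∃; _×_; _,_)
open import Data.Unit using (⊤)
open import Data.Empty using (⊥)
open import Function.Bundles using (_⇔_)
open import Relation.Binary.Construct.Closure.ReflexiveTransitive using (Star)

-- Actions over input alphabet I and output alphabet O.
-- Visible alphabet A = I ⊎ O (so I, O are disjoint and τ ∉ A by construction).
data Act (I O : Set) : Set where
  τ   : Act I O
  vis : I ⊎ O → Act I O

record MTS (I O : Set) : Set₂ where
  field
    St   : Set
    Must : St → I ⊎ O → (St → Set) → Set₁
    May  : St → Act I O → St → Set

record IsMIA {I O : Set} (M : MTS I O) : Set₁ where
  open MTS M
  field
    must-nonempty : ∀ {p a S} → Must p a S → ∃ λ p' → S p'
    consistency   : ∀ {p a S p'} → Must p a S → S p' → May p (vis a) p'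
    input-det     : ∀ {p i S S'} → Must p (inj₁ i) S → Must p (inj₁ i) S' →
                    ∀ x → S x ⇔ S' x
    input-may     : ∀ {p i p'} → May p (vis (inj₁ i)) p' →
                    Σ (St → Set) λ S → Must p (inj₁ i) S × S p'

record MIA (I O : Set) : Set₂ where
  field
    mts   : MTS I O
    isMIA : IsMIA mts
  open MTS mts public

module _ {I O : Set} (M : MTS I O) where
  open MTS M

  WeakEps : St → St → Set
  WeakEps = Star (λ x y → May x τ y)

  WeakAct : St → Act I O → St → Set
  WeakAct p α p' = ∃ λ p'' → WeakEps p p'' × May p'' α p'

  WeakHat : St → Act I O → St → Set
  WeakHat q τ       q' = WeakEps q q'
  WeakHat q (vis a) q' = WeakAct q (vis a) q'

OutOrTau : {I O : Set} → Act I O → Set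
OutOrTau τ              = ⊤
OutOrTau (vis (inj₁ _)) = ⊥
OutOrTau (vis (inj₂ _)) = ⊤

module _ {I O : Set} (P Q : MTS I O) where
  private
    module P = MTS P
    module Q = MTS Q

  IsMIARefinement : (P.St → Q.St → Set) → Set₁
  IsMIARefinement R = ∀ p q → R p q →
    (∀ a Q' → Q.Must q a Q' →
       Σ (P.St → Set) λ P' → P.Must p a P' ×
         (∀ p' → P' p' → ∃ λ q' → Q' q' × R p' q'))
    ×
    (∀ α p' → OutOrTau α → P.May p α p' →
       ∃ λ q' → WeakHat Q q α q' × R p' q')

  RefinesMIA : P.St → Q.St → Set₁
  RefinesMIA p q = Σ (P.St → Q.St → Set) λ R → IsMIARefinement R × R p q

module _ {I O : Set} (P Q : MTS I O) where
  private
    module P = MTS P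
    module Q = MTS Q

  -- states {p ∨ q} ∪ P ∪ Q (disjoint by construction)
  data DSt : Set where
    _∨ₛ_ : P.St → Q.St → DSt
    inP  : P.St → DSt
    inQ  : Q.St → DSt

  liftP : (P.St → Set) → DSt → Set
  liftP S (inP x) = S x
  liftP S _       = ⊥

  liftQ : (Q.St → Set) → DSt → Set
  liftQ T (inQ y) = T y
  liftQ T _       = ⊥

  unionPQ : (P.St → Set) → (Q.St → Set) → DSt → Set
  unionPQ S T (inP x) = S x
  unionPQ S T (inQ y) = T y
  unionPQ S T (_ ∨ₛ _) = ⊥

  InputGuard : {St : Set} → (St → Act I O → St → Set) → St → Act I O → Set
  InputGuard May r (vis (inj₁ i)) = ∃ λ r' → May r (vis (inj₁ i)) r'
  InputGuard May r _              = ⊤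

  data DMust : DSt → I ⊎ O → (DSt → Set) → Set₁ where
    mustP  : ∀ {p a S} → P.Must p a S → DMust (inP p) a (liftP S)
    mustQ  : ∀ {q a T} → Q.Must q a T → DMust (inQ q) a (liftQ T)
    mustPQ : ∀ {p q a S T} → P.Must p a S → Q.Must q a T →
             DMust (p ∨ₛ q) a (unionPQ S T)

  data DMay : DSt → Act I O → DSt → Set where
    mayP  : ∀ {p α p'} → P.May p α p' → DMay (inP p) α (inP p')
    mayQ  : ∀ {q α q'} → Q.May q α q' → DMay (inQ q) α (inQ q')
    may1  : ∀ {p q α p'} → P.May p α p' → InputGuard Q.May q α →
            DMay (p ∨ₛ q) α (inP p')
    may2  : ∀ {p q α q'} → Q.May q α q' → InputGuard P.May p α →
            DMay (p ∨ₛ q) α (inQ q')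

  Disj : MTS I O
  Disj = record { St = DSt ; Must = DMust ; May = DMay }

-- Given a refinement relation for p ∨ q, a disjunct inherits the pairs of
-- its own copy and of every disjunction it occurs in: the must-transitions
-- of x ∨ y are unions containing those of x, and every output or τ
-- may-step of x is also one of x ∨ y, since the input guard is vacuous.
-- Conversely, relating x ∨ y to r when x and y are both related to r gives
-- a refinement relation, because the must-transitions of x ∨ y require
-- matching ones in both x and y.
module Submission where

open import Defs
open import Data.Product using (_×_; _,_; Σ; ∃; proj₁; proj₂; map₂)
open import Data.Sum using (_⊎_; inj₁; inj₂)
open import Data.Unit using (tt)
open import Function.Bundles using (_⇔_; mk⇔)

module _ {I O : Set} (P Q : MTS I O) where
  private
    module P = MTS P
    module Q = MTS Q

  MustSimulated : (P.St → Q.St → Set) → P.St → Q.St → Set₁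
  MustSimulated Rel p q = ∀ a Q' → Q.Must q a Q' →
    Σ (P.St → Set) λ P' → P.Must p a P' ×
      (∀ p' → P' p' → ∃ λ q' → Q' q' × Rel p' q')

  MaySimulated : (P.St → Q.St → Set) → P.St → Q.St → Set
  MaySimulated Rel p q = ∀ α p' → OutOrTau α → P.May p α p' →
    ∃ λ q' → WeakHat Q q α q' × Rel p' q'

  outOrTau⇒inputGuard : ∀ {St} (May : St → Act I O → St → Set) {r} α →
                        OutOrTau α → InputGuard P Q May r α
  outOrTau⇒inputGuard May τ              _ = tt
  outOrTau⇒inputGuard May (vis (inj₂ _)) _ = tt

module _ {I O : Set} (P Q R : MTS I O) where
  private
    module P = MTS P
    module Q = MTS Q
    module R = MTS R
    D = Disj P Q

  leftRel : (DSt P Q → R.St → Set) → P.St → R.St → Set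
  leftRel Rel x r = Rel (inP x) r ⊎ ∃ λ y → Rel (x ∨ₛ y) r

  rightRel : (DSt P Q → R.St → Set) → Q.St → R.St → Set
  rightRel Rel y r = Rel (inQ y) r ⊎ ∃ λ x → Rel (x ∨ₛ y) r

  leftRel-isMIARefinement : ∀ Rel → IsMIARefinement D R Rel →
                            IsMIARefinement P R (leftRel Rel)
  leftRel-isMIARefinement Rel ref x r (inj₁ h) = must , may
    where
    must : MustSimulated P R (leftRel Rel) x r
    must a R' m with proj₁ (ref (inP x) r h) a R' m
    ... | _ , mustP {S = S} ms , sim = S , ms , λ x' s → map₂ (map₂ inj₁) (sim (inP x') s)
    may : MaySimulated P R (leftRel Rel) x r
    may α x' o mx = map₂ (map₂ inj₁) (proj₂ (ref (inP x) r h) α (inP x') o (mayP mx))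
  leftRel-isMIARefinement Rel ref x r (inj₂ (y , h)) = must , may
    where
    must : MustSimulated P R (leftRel Rel) x r
    must a R' m with proj₁ (ref (x ∨ₛ y) r h) a R' m
    ... | _ , mustPQ {S = S} ms _ , sim = S , ms , λ x' s → map₂ (map₂ inj₁) (sim (inP x') s)
    may : MaySimulated P R (leftRel Rel) x r
    may α x' o mx = map₂ (map₂ inj₁)
      (proj₂ (ref (x ∨ₛ y) r h) α (inP x') o (may1 mx (outOrTau⇒inputGuard P Q Q.May α o)))

  rightRel-isMIARefinement : ∀ Rel → IsMIARefinement D R Rel →
                             IsMIARefinement Q R (rightRel Rel)
  rightRel-isMIARefinement Rel ref y r (inj₁ h) = must , may
    where
    must : MustSimulated Q R (rightRel Rel) y r
    must a R' m with proj₁ (ref (inQ y) r h) a R' m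
    ... | _ , mustQ {T = T} mt , sim = T , mt , λ y' t → map₂ (map₂ inj₁) (sim (inQ y') t)
    may : MaySimulated Q R (rightRel Rel) y r
    may α y' o my = map₂ (map₂ inj₁) (proj₂ (ref (inQ y) r h) α (inQ y') o (mayQ my))
  rightRel-isMIARefinement Rel ref y r (inj₂ (x , h)) = must , may
    where
    must : MustSimulated Q R (rightRel Rel) y r
    must a R' m with proj₁ (ref (x ∨ₛ y) r h) a R' m
    ... | _ , mustPQ {T = T} _ mt , sim = T , mt , λ y' t → map₂ (map₂ inj₁) (sim (inQ y') t)
    may : MaySimulated Q R (rightRel Rel) y r
    may α y' o my = map₂ (map₂ inj₁)
      (proj₂ (ref (x ∨ₛ y) r h) α (inQ y') o (may2 my (outOrTau⇒inputGuard P Q P.May α o)))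

  joinRel : (P.St → R.St → Set) → (Q.St → R.St → Set) → DSt P Q → R.St → Set
  joinRel R₁ R₂ (inP x)  r = R₁ x r
  joinRel R₁ R₂ (inQ y)  r = R₂ y r
  joinRel R₁ R₂ (x ∨ₛ y) r = R₁ x r × R₂ y r

  joinRel-isMIARefinement : ∀ R₁ R₂ → IsMIARefinement P R R₁ → IsMIARefinement Q R R₂ →
                            IsMIARefinement D R (joinRel R₁ R₂)
  joinRel-isMIARefinement R₁ R₂ ref₁ ref₂ (inP x) r h = must , may
    where
    must : MustSimulated D R (joinRel R₁ R₂) (inP x) r
    must a R' m with proj₁ (ref₁ x r h) a R' m
    ... | S , ms , sim = liftP P Q S , mustP ms , λ { (inP x') s → sim x' s }
    may : MaySimulated D R (joinRel R₁ R₂) (inP x) r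
    may α _ o (mayP mx) = proj₂ (ref₁ x r h) α _ o mx
  joinRel-isMIARefinement R₁ R₂ ref₁ ref₂ (inQ y) r h = must , may
    where
    must : MustSimulated D R (joinRel R₁ R₂) (inQ y) r
    must a R' m with proj₁ (ref₂ y r h) a R' m
    ... | T , mt , sim = liftQ P Q T , mustQ mt , λ { (inQ y') t → sim y' t }
    may : MaySimulated D R (joinRel R₁ R₂) (inQ y) r
    may α _ o (mayQ my) = proj₂ (ref₂ y r h) α _ o my
  joinRel-isMIARefinement R₁ R₂ ref₁ ref₂ (x ∨ₛ y) r (h₁ , h₂) = must , may
    where
    must : MustSimulated D R (joinRel R₁ R₂) (x ∨ₛ y) r
    must a R' m with proj₁ (ref₁ x r h₁) a R' m | proj₁ (ref₂ y r h₂) a R' m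
    ... | S , ms , simS | T , mt , simT =
      unionPQ P Q S T , mustPQ ms mt , λ { (inP x') s → simS x' s ; (inQ y') t → simT y' t }
    may : MaySimulated D R (joinRel R₁ R₂) (x ∨ₛ y) r
    may α _ o (may1 mx _) = proj₂ (ref₁ x r h₁) α _ o mx
    may α _ o (may2 my _) = proj₂ (ref₂ y r h₂) α _ o my

  ∨-refines⇔ : ∀ p q r → RefinesMIA D R (p ∨ₛ q) r ⇔ (RefinesMIA P R p r × RefinesMIA Q R q r)
  ∨-refines⇔ p q r = mk⇔ split join
    where
    split : RefinesMIA D R (p ∨ₛ q) r → RefinesMIA P R p r × RefinesMIA Q R q r
    split (Rel , ref , h) = (leftRel Rel , leftRel-isMIARefinement Rel ref , inj₂ (q , h))
                          , (rightRel Rel , rightRel-isMIARefinement Rel ref , inj₂ (p , h))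
    join : RefinesMIA P R p r × RefinesMIA Q R q r → RefinesMIA D R (p ∨ₛ q) r
    join ((R₁ , ref₁ , h₁) , (R₂ , ref₂ , h₂)) =
      joinRel R₁ R₂ , joinRel-isMIARefinement R₁ R₂ ref₁ ref₂ , (h₁ , h₂)

theorem4p10 : {I O : Set} (P Q R : MIA I O) →
    (p : MIA.St P) (q : MIA.St Q) (r : MIA.St R) →
    RefinesMIA (Disj (MIA.mts P) (MIA.mts Q)) (MIA.mts R) (_∨ₛ_ p q) r
      ⇔ (RefinesMIA (MIA.mts P) (MIA.mts R) p r × RefinesMIA (MIA.mts Q) (MIA.mts R) q r)
theorem4p10 P Q R = ∨-refines⇔ (MIA.mts P) (MIA.mts Q) (MIA.mts R)
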